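{- Let $l,d$ be integers with $9\le l\le 12$ and $l+3\le d\le 2l$, let $n=d-3$, let $\mathcal{C}$ be any symmetric chain decomposition of $2^{[n]}$ and let $\phi$ be the associated map (for $|X|>n/2$, $\phi(X)$ is the element of size $|X|-1$ of the chain of $\mathcal{C}$ containing $X$). Let $A\subseteq[n]$ with $|A|=l$, and set $B=\phi(A)$ and $C=\phi(B)$. Then the union of the $3$-cubes of $Q^d$ labeled $A$, $B$ and $C$ is $\mathbf{0}$-stackable.
   Context: $[n]=\{1,\dots,n\}$. A chain is a sequence $(S_1,\dots,S_t)$ of subsets of $[n]$ with $S_i\subseteq S_{i+1}$; it is saturated if $|S_{i+1}|=|S_i|+1$, symmetric if moreover $|S_1|+|S_t|=n$; a symmetric chain decomposition of $2^{[n]}$ is a family of symmetric saturated chains partitioning all subsets of $[n]$. $Q^d$ has vertex set $\{0,1\}^d$, adjacency meaning differing in exactly one coordinate; $\mathbf{0}$ is the all-zeros vertex. Writing $Q^d=Q^{d-3}\,\square\,Q^3$, for $S\subseteq[d-3]$ the $3$-cube labeled $S$ is the set of vertices whose first $d-3$ coordinates are the indicator vector of $S$. A cup stacking move from $u$ to $v$ (for a configuration $C:V\to\mathbb{N}$ of cups) is allowed when $u,v$ each carry at least one cup and $\mathrm{dist}_{Q^d}(u,v)$ equals the number of cups on $u$; it moves all cups of $u$ onto $v$. A set $U$ of vertices is $\mathbf{0}$-stackable if, starting from one cup on each vertex of $U\cup\{\mathbf{0}\}$ and none elsewhere, some sequence of moves in $Q^d$ puts all cups on $\mathbf{0}$.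 -}

module Defs where

open import Data.Nat using (ℕ; zero; suc; _+_; _*_; _≤_)
open import Data.Bool using (Bool; true; false; if_then_else_; _∨_)
open import Data.Bool.Properties using () renaming (_≟_ to _≟ᵇ_)
open import Data.Vec using (Vec; []; _∷_; take; replicate)
open import Data.Vec.Properties using (≡-dec)
open import Data.List using (List; []; _∷_; length; filter; concat)
open import Data.List.Membership.Propositional using (_∈_)
open import Data.List.Relation.Unary.All using (All)
open import Data.Fin.Subset using (Subset; _⊆_; ∣_∣)
open import Data.Product using (Σ; _×_; ∃)
open import Relation.Nullary using (¬_; does; Dec)
open import Data.Empty using (⊥)
open import Data.Unit using (⊤)
open import Relation.Binary.PropositionalEquality using (_≡_)
open import Relation.Binary.Construct.Closure.ReflexiveTransitive using (Star)

_≟ˢ_ : ∀ {n} (X Y : Subset n) → Dec (X ≡ Y)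
_≟ˢ_ = ≡-dec _≟ᵇ_

Saturated : ∀ {n} → List (Subset n) → Set
Saturated []            = ⊥
Saturated (S ∷ [])      = ⊤
Saturated (S ∷ T ∷ Ss)  = (S ⊆ T) × (∣ T ∣ ≡ suc ∣ S ∣) × Saturated (T ∷ Ss)

lastOf : ∀ {A : Set} → A → List A → A
lastOf a []       = a
lastOf a (b ∷ bs) = lastOf b bs

SymmetricChain : ∀ n → List (Subset n) → Set
SymmetricChain n []       = Saturated {n} []
SymmetricChain n (S ∷ Ss) = Saturated (S ∷ Ss) × (∣ S ∣ + ∣ lastOf S Ss ∣ ≡ n)

occ : ∀ {n} → Subset n → List (Subset n) → ℕ
occ X Ss = length (filter (X ≟ˢ_) Ss)

IsSCD : ∀ n → List (List (Subset n)) → Set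
IsSCD n 𝒞 = All (SymmetricChain n) 𝒞 × (∀ (X : Subset n) → occ X (concat 𝒞) ≡ 1)

-- graph of the associated map φ: φ(X) = Y iff Y is the element of size |X|-1
-- of the chain of 𝒞 containing X  (used only for 2|X| > n)
PhiOf : ∀ {n} → List (List (Subset n)) → Subset n → Subset n → Set
PhiOf 𝒞 X Y = Σ _ λ ch → (ch ∈ 𝒞) × (X ∈ ch) × (Y ∈ ch) × (suc ∣ Y ∣ ≡ ∣ X ∣)

Vertex : ℕ → Set
Vertex d = Vec Bool d

zeroV : ∀ d → Vertex d
zeroV d = replicate d false

-- graph distance in Q^d = Hamming distance
dist : ∀ {d} → Vertex d → Vertex d → ℕ
dist []       []       = 0
dist (x ∷ xs) (y ∷ ys) = (if does (x ≟ᵇ y) then 0 else 1) + dist xs ys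

Config : ℕ → Set
Config d = Vertex d → ℕ

Move : ∀ {d} → Config d → Config d → Set
Move {d} C C' = ∃ λ (u : Vertex d) → ∃ λ (v : Vertex d) →
    (1 ≤ C u) × (1 ≤ C v) × (dist u v ≡ C u)
  × (C' u ≡ 0) × (C' v ≡ C v + C u)
  × (∀ w → ¬ (w ≡ u) → ¬ (w ≡ v) → C' w ≡ C w)

initConfig : ∀ d → (Vertex d → Bool) → Config d
initConfig d U w = if (U w ∨ does (≡-dec _≟ᵇ_ w (zeroV d))) then 1 else 0

ZeroStackable : ∀ d → (Vertex d → Bool) → Set
ZeroStackable d U = ∃ λ (C : Config d) →
  Star Move (initConfig d U) C × (∀ w → ¬ (w ≡ zeroV d) → C w ≡ 0)

-- Q^{n+3} = Q^n □ Q^3 ; the 3-cube labeled S consists of vertices whose first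
-- n coordinates are the indicator of S.

label : ∀ n → Vertex (n + 3) → Subset n
label n w = take n w

cubes3 : ∀ n → Subset n → Subset n → Subset n → Vertex (n + 3) → Bool
cubes3 n A B C w = does (label n w ≟ˢ A) ∨ does (label n w ≟ˢ B) ∨ does (label n w ≟ˢ C)

-- Since φ(A) = B and φ(B) = C lie on one chain of the decomposition, C ⊂ B ⊂ A is a saturated
-- chain with ∣ C ∣ = m = l − 2 ∈ [7, 10]. All Hamming distances among the 25 vertices involved (the
-- three 3-cubes and 𝟎) are then determined by m and the last three coordinates, so cup stacking on
-- them is a finite game depending only on m. For each of the four values of m an explicit winning
-- play is checked by evaluation, and transported to Q^d along the distance-preserving embedding.
module Submission where

open import Defs
open import Data.Bool using (Bool; true; false; if_then_else_; _∨_)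
open import Data.Bool.Properties using () renaming (_≟_ to _≟ᵇ_)
open import Data.Empty using (⊥-elim)
open import Data.Fin using (Fin; zero; suc; toℕ; _≟_)
open import Data.Fin.Patterns using (0F; 1F; 2F)
open import Data.Fin.Properties using (toℕ-injective)
open import Data.Fin.Subset using (Subset; _⊆_; ∣_∣)
open import Data.Fin.Subset.Properties using (drop-∷-⊆; ⊆-refl; ⊆-trans; p⊆q⇒∣p∣≤∣q∣; ∣⊥∣≡0)
open import Data.List using (List; []; _∷_; lookup; allFin; cartesianProductWith)
open import Data.List.Membership.Propositional using (_∈_)
open import Data.List.Membership.Propositional.Properties using (∈-lookup; ∈-allFin; ∈-cartesianProductWith⁺)
open import Data.List.Relation.Unary.All as All using (All)
open import Data.List.Relation.Unary.Any using (here; there)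
open import Data.Maybe using (Maybe; just; nothing; maybe′)
import Data.Maybe.Properties as Maybe
open import Data.Nat using (ℕ; suc; _+_; _*_; _≤_; ∣_-_∣; _≤?_)
open import Data.Nat.Properties
  using (+-assoc; +-suc; +-cancelʳ-≡; +-cancelˡ-≤; ≤-trans; ≤-reflexive; 1+n≰n; m<n⇒n≢0;
         ∣m-n∣≡0⇒m≡n; m+n≡0⇒n≡0; m+n≤o⇒m≤o; m≤n⇒∃[o]m+o≡n)
  renaming (_≟_ to _≟ℕ_)
open import Data.Product using (_×_; _,_; ∃; proj₂)
import Data.Product.Properties as Product
open import Data.Sum using (_⊎_; inj₁; inj₂)
open import Data.Vec using (Vec; []; _∷_; _++_; take; drop)
import Data.Vec.Base as Vec
open import Data.Vec.Properties using (≡-dec; take++drop≡id; ++-injectiveˡ; ++-injectiveʳ)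
open import Function using (const)
open import Relation.Binary.Definitions using (DecidableEquality)
open import Relation.Binary.PropositionalEquality
  using (_≡_; _≢_; _≗_; refl; sym; trans; cong; cong₂; subst; module ≡-Reasoning)
open import Relation.Binary.Construct.Closure.ReflexiveTransitive using (Star; ε; _◅_)
open import Relation.Nullary using (Dec; yes; no; does; contradiction)
open import Relation.Nullary.Decidable using (_×-dec_; dec-true; dec-false; from-yes)

dist-refl : ∀ {k} (x : Vec Bool k) → dist x x ≡ 0
dist-refl []          = refl
dist-refl (true ∷ x)  = dist-refl x
dist-refl (false ∷ x) = dist-refl x

dist-sym : ∀ {k} (x y : Vec Bool k) → dist x y ≡ dist y x
dist-sym []          []          = refl
dist-sym (true ∷ x)  (true ∷ y)  = dist-sym x y
dist-sym (true ∷ x)  (false ∷ y) = cong suc (dist-sym x y)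
dist-sym (false ∷ x) (true ∷ y)  = cong suc (dist-sym x y)
dist-sym (false ∷ x) (false ∷ y) = dist-sym x y

dist-++ : ∀ {a b} (x y : Vec Bool a) (x′ y′ : Vec Bool b) →
          dist (x ++ x′) (y ++ y′) ≡ dist x y + dist x′ y′
dist-++ []      []      x′ y′ = refl
dist-++ (s ∷ x) (t ∷ y) x′ y′ =
  trans (cong (_ +_) (dist-++ x y x′ y′)) (sym (+-assoc _ (dist x y) (dist x′ y′)))

dist-zeroV : ∀ {k} (S : Subset k) → dist S (zeroV k) ≡ ∣ S ∣
dist-zeroV []          = refl
dist-zeroV (true ∷ S)  = cong suc (dist-zeroV S)
dist-zeroV (false ∷ S) = dist-zeroV S

dist-⊆ : ∀ {k} {S T : Subset k} → S ⊆ T → dist S T + ∣ S ∣ ≡ ∣ T ∣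
dist-⊆ {S = []}        {[]}        _   = refl
dist-⊆ {S = true ∷ S}  {true ∷ T}  S⊆T =
  trans (+-suc (dist S T) ∣ S ∣) (cong suc (dist-⊆ (drop-∷-⊆ S⊆T)))
dist-⊆ {S = false ∷ S} {true ∷ T}  S⊆T = cong suc (dist-⊆ (drop-∷-⊆ S⊆T))
dist-⊆ {S = false ∷ S} {false ∷ T} S⊆T = dist-⊆ (drop-∷-⊆ S⊆T)
dist-⊆ {S = true ∷ S}  {false ∷ T} S⊆T with S⊆T Vec.here
... | ()

zeroV-++ : ∀ a {b} → zeroV (a + b) ≡ zeroV a ++ zeroV b
zeroV-++ 0       = refl
zeroV-++ (suc a) = cong (false ∷_) (zeroV-++ a)

take-++ : ∀ {A : Set} a {b} (x : Vec A a) (y : Vec A b) → take a (x ++ y) ≡ x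
take-++ a x y = ++-injectiveˡ (take a (x ++ y)) x (take++drop≡id a (x ++ y))

drop-++ : ∀ {A : Set} a {b} (x : Vec A a) (y : Vec A b) → drop a (x ++ y) ≡ y
drop-++ a x y = ++-injectiveʳ (take a (x ++ y)) x (take++drop≡id a (x ++ y))

Move-respˡ : ∀ {d} {C D E : Config d} → C ≗ D → Move D E → Move C E
Move-respˡ C≗D (u , v , 1≤u , 1≤v , dist≡ , E-u , E-v , E-w) =
  u , v , subst (1 ≤_) (sym (C≗D u)) 1≤u , subst (1 ≤_) (sym (C≗D v)) 1≤v ,
  trans dist≡ (sym (C≗D u)) , E-u , trans E-v (sym (cong₂ _+_ (C≗D v) (C≗D u))) ,
  λ w w≢u w≢v → trans (E-w w w≢u w≢v) (sym (C≗D w))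

head-⊆ : ∀ {k} {S X : Subset k} {Ss} → Saturated (S ∷ Ss) → X ∈ S ∷ Ss → S ⊆ X
head-⊆ _                             (here refl) = ⊆-refl
head-⊆ {Ss = _ ∷ _} (S⊆T , _ , sat) (there X∈)  = ⊆-trans S⊆T (head-⊆ sat X∈)

saturated-comparable : ∀ {k} {X Y : Subset k} ch →
                       Saturated ch → X ∈ ch → Y ∈ ch → X ⊆ Y ⊎ Y ⊆ X
saturated-comparable (S ∷ Ss)     sat           (here refl) Y∈          = inj₁ (head-⊆ sat Y∈)
saturated-comparable (S ∷ Ss)     sat           (there X∈)  (here refl) = inj₂ (head-⊆ sat (there X∈))
saturated-comparable (S ∷ T ∷ Ts) (_ , _ , sat) (there X∈)  (there Y∈)  =
  saturated-comparable (T ∷ Ts) sat X∈ Y∈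

symmetric⇒saturated : ∀ {n ch} → SymmetricChain n ch → Saturated ch
symmetric⇒saturated {ch = _ ∷ _} (sat , _) = sat

phi-⊆ : ∀ {n} {𝒞 : List (List (Subset n))} {X Y} → IsSCD n 𝒞 → PhiOf 𝒞 X Y → Y ⊆ X
phi-⊆ (symmetric , _) (ch , ch∈𝒞 , X∈ , Y∈ , 1+∣Y∣≡∣X∣)
  with saturated-comparable ch (symmetric⇒saturated (All.lookup symmetric ch∈𝒞)) X∈ Y∈
... | inj₂ Y⊆X = Y⊆X
... | inj₁ X⊆Y = ⊥-elim (1+n≰n (≤-trans (≤-reflexive 1+∣Y∣≡∣X∣) (p⊆q⇒∣p∣≤∣q∣ X⊆Y)))

phi-saturated : ∀ {n} {𝒞 : List (List (Subset n))} {A B C} → IsSCD n 𝒞 →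
                PhiOf 𝒞 A B → PhiOf 𝒞 B C → Saturated (C ∷ B ∷ A ∷ [])
phi-saturated scd φAB@(_ , _ , _ , _ , ∣B∣≡) φBC@(_ , _ , _ , _ , ∣C∣≡) =
  phi-⊆ scd φBC , sym ∣C∣≡ , phi-⊆ scd φAB , sym ∣B∣≡ , _

∣lookup∣ : ∀ {k} {S : Subset k} {Ss} → Saturated (S ∷ Ss) →
           ∀ i → ∣ lookup (S ∷ Ss) i ∣ ≡ toℕ i + ∣ S ∣
∣lookup∣ _                               zero    = refl
∣lookup∣ {S = S} {T ∷ _} (_ , ∣T∣≡ , sat) (suc i) =
  trans (∣lookup∣ sat i) (trans (cong (toℕ i +_) ∣T∣≡) (+-suc (toℕ i) ∣ S ∣))

dist-head-lookup : ∀ {k} {S : Subset k} {Ss} → Saturated (S ∷ Ss) →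
                   ∀ j → dist S (lookup (S ∷ Ss) j) ≡ toℕ j
dist-head-lookup {S = S} sat j =
  +-cancelʳ-≡ ∣ S ∣ _ _ (trans (dist-⊆ (head-⊆ sat (∈-lookup j))) (∣lookup∣ sat j))

dist-lookup : ∀ {k} {S : Subset k} {Ss} → Saturated (S ∷ Ss) →
              ∀ i j → dist (lookup (S ∷ Ss) i) (lookup (S ∷ Ss) j) ≡ ∣ toℕ i - toℕ j ∣
dist-lookup                sat           zero    j       = dist-head-lookup sat j
dist-lookup {S = S} {Ss}   sat           (suc i) zero    =
  trans (dist-sym (lookup Ss i) S) (dist-head-lookup sat (suc i))
dist-lookup {Ss = _ ∷ _}   (_ , _ , sat) (suc i) (suc j) = dist-lookup sat i j

module CupGame {P : Set} (_≟ᴾ_ : DecidableEquality P) (δ : P → P → ℕ) where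

  Legal : (P → ℕ) → P × P → Set
  Legal c (u , v) = 1 ≤ c u × 1 ≤ c v × δ u v ≡ c u

  stack : (P → ℕ) → P × P → P → ℕ
  stack c (u , v) p = if does (p ≟ᴾ u) then 0 else if does (p ≟ᴾ v) then c v + c u else c p

  stack-source : ∀ c u v → stack c (u , v) u ≡ 0
  stack-source c u v rewrite dec-true (u ≟ᴾ u) refl = refl

  stack-target : ∀ c {u v} → v ≢ u → stack c (u , v) v ≡ c v + c u
  stack-target c {u} {v} v≢u
    rewrite dec-false (v ≟ᴾ u) v≢u | dec-true (v ≟ᴾ v) refl = refl

  stack-elsewhere : ∀ c {u v p} → p ≢ u → p ≢ v → stack c (u , v) p ≡ c p
  stack-elsewhere c {u} {v} {p} p≢u p≢v
    rewrite dec-false (p ≟ᴾ u) p≢u | dec-false (p ≟ᴾ v) p≢v = refl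

  Clears : List P → (P → ℕ) → List (P × P) → Set
  Clears ps c []        = All (λ p → c p ≡ 0) ps
  Clears ps c (mv ∷ ms) = Legal c mv × Clears ps (stack c mv) ms

  clears? : ∀ ps c ms → Dec (Clears ps c ms)
  clears? ps c []             = All.all? (λ p → c p ≟ℕ 0) ps
  clears? ps c ((u , v) ∷ ms) =
    (1 ≤? c u ×-dec 1 ≤? c v ×-dec δ u v ≟ℕ c u) ×-dec clears? ps (stack c (u , v)) ms

-- `cube i x` models the vertex Sᵢ ++ x of Q^(n+3) over a saturated chain S₀ ⊂ S₁ ⊂ S₂ with
-- ∣ S₀ ∣ = m, and `origin` models 𝟎; δ m is their Hamming distance (see `dist-vertex`).
Pos : Set
Pos = Maybe (Fin 3 × Vec Bool 3)

pattern origin   = nothing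
pattern cube i x = just (i , x)

_≟ᴾ_ : DecidableEquality Pos
_≟ᴾ_ = Maybe.≡-dec (Product.≡-dec _≟_ (≡-dec _≟ᵇ_))

δ : ℕ → Pos → Pos → ℕ
δ m (cube i x) (cube j y) = ∣ toℕ i - toℕ j ∣ + dist x y
δ m (cube i x) origin     = toℕ i + m + dist x (zeroV 3)
δ m origin     (cube j y) = toℕ j + m + dist (zeroV 3) y
δ m origin     origin     = 0

module ChainGame (m : ℕ) = CupGame _≟ᴾ_ (δ m)
open ChainGame

bitVectors : ∀ k → List (Vec Bool k)
bitVectors 0       = [] ∷ []
bitVectors (suc k) = cartesianProductWith _∷_ (false ∷ true ∷ []) (bitVectors k)

∈-bitVectors : ∀ {k} (x : Vec Bool k) → x ∈ bitVectors k
∈-bitVectors []          = here refl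
∈-bitVectors (false ∷ x) = ∈-cartesianProductWith⁺ _∷_ {xs = false ∷ true ∷ []} (here refl) (∈-bitVectors x)
∈-bitVectors (true ∷ x)  =
  ∈-cartesianProductWith⁺ _∷_ {xs = false ∷ true ∷ []} (there (here refl)) (∈-bitVectors x)

cubePositions : List Pos
cubePositions = cartesianProductWith cube (allFin 3) (bitVectors 3)

∈-cubePositions : ∀ i x → cube i x ∈ cubePositions
∈-cubePositions i x = ∈-cartesianProductWith⁺ cube (∈-allFin i) (∈-bitVectors x)

module Certificates where

  O I : Bool
  O = false
  I = true

  A B C : Bool → Bool → Bool → Pos
  A x y z = cube 2F (x ∷ y ∷ z ∷ [])
  B x y z = cube 1F (x ∷ y ∷ z ∷ [])
  C x y z = cube 0F (x ∷ y ∷ z ∷ [])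

  infix 6 _↦_
  _↦_ : Pos → Pos → Pos × Pos
  _↦_ = _,_

  moves7 : List (Pos × Pos)
  moves7 =
    B I O O ↦ C I O O ∷
    A O I O ↦ A O I I ∷
    B I O I ↦ B O O I ∷
    C O I I ↦ B O I I ∷
    A O O O ↦ B O O O ∷
    A I O I ↦ A I O O ∷
    C O I O ↦ B O I O ∷
    C O O O ↦ B O O O ∷
    B I I I ↦ B I I O ∷
    C I O I ↦ C I I I ∷
    B O I O ↦ C I I O ∷
    C I I O ↦ C O O I ∷
    B O I I ↦ B I I O ∷
    C I I I ↦ C I O O ∷
    B I I O ↦ C O O I ∷
    C O O I ↦ origin ∷
    A O O I ↦ B O O I ∷
    B O O I ↦ A I I I ∷
    A O I I ↦ A I I O ∷
    A I O O ↦ B O O O ∷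
    A I I O ↦ B O O O ∷
    B O O O ↦ origin ∷
    A I I I ↦ C I O O ∷
    C I O O ↦ origin ∷
    []

  moves8 : List (Pos × Pos)
  moves8 =
    B I O O ↦ B I I O ∷
    C I O I ↦ C I O O ∷
    A O O I ↦ A O I I ∷
    A I I I ↦ A I O I ∷
    B I I I ↦ C I I I ∷
    C O O O ↦ C I O O ∷
    C I O O ↦ B O I O ∷
    B O O O ↦ A O O O ∷
    A I I O ↦ B I I O ∷
    A O O O ↦ A I O I ∷
    C I I I ↦ C O O I ∷
    B I I O ↦ A O I I ∷
    C O I I ↦ B O I I ∷
    C O O I ↦ A O I I ∷
    B O I O ↦ A I O I ∷
    B O O I ↦ B I O I ∷
    B O I I ↦ C O I O ∷
    B I O I ↦ A I O O ∷
    A I O O ↦ C I I O ∷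
    C O I O ↦ A O I I ∷
    C I I O ↦ A I O I ∷
    A I O I ↦ origin ∷
    A O I O ↦ A O I I ∷
    A O I I ↦ origin ∷
    []

  moves9 : List (Pos × Pos)
  moves9 =
    B I O O ↦ B I I O ∷
    C I O I ↦ C I O O ∷
    A O O I ↦ A O I I ∷
    A I I I ↦ A I O I ∷
    B I I I ↦ C I I I ∷
    C O O O ↦ C I O O ∷
    C I O O ↦ B O I O ∷
    B O O O ↦ A O O O ∷
    A I I O ↦ B I I O ∷
    A O O O ↦ A I O I ∷
    C I I I ↦ C O O I ∷
    B I I O ↦ A O I I ∷
    C O I I ↦ B O I I ∷
    C O O I ↦ C I I O ∷
    C I I O ↦ A O I I ∷
    B O O I ↦ B I O I ∷
    A I O I ↦ B O I O ∷
    A O I O ↦ A O I I ∷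
    B O I I ↦ C O I O ∷
    B I O I ↦ A I O O ∷
    C O I O ↦ A O I I ∷
    A O I I ↦ origin ∷
    A I O O ↦ B O I O ∷
    B O I O ↦ origin ∷
    []

  moves10 : List (Pos × Pos)
  moves10 =
    A O I I ↦ A I I I ∷
    B I I O ↦ B I O O ∷
    B I O I ↦ B I I I ∷
    B I O O ↦ C O O O ∷
    B O I I ↦ C O I I ∷
    C O O O ↦ A O O I ∷
    A O O O ↦ A O I O ∷
    A I O O ↦ A I O I ∷
    A O I O ↦ A I I I ∷
    B I I I ↦ C I O I ∷
    A I O I ↦ B O O I ∷
    C I O I ↦ A O O I ∷
    C I O O ↦ C I I O ∷
    C I I O ↦ A I I O ∷
    B O I O ↦ C O I O ∷
    C O I O ↦ B O O O ∷
    C O O I ↦ C O I I ∷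
    A I I I ↦ B O O O ∷
    A I I O ↦ A O O I ∷
    B O O I ↦ C I I I ∷
    C O I I ↦ A O O I ∷
    A O O I ↦ origin ∷
    C I I I ↦ B O O O ∷
    B O O O ↦ origin ∷
    []

  certificate : ∀ {m} → 7 ≤ m → m ≤ 10 → ∃ λ ms → Clears m cubePositions (const 1) ms
  certificate 7≤m m≤10 with m≤n⇒∃[o]m+o≡n 7≤m
  ... | 0                       , refl = moves7  , from-yes (clears? 7  cubePositions (const 1) moves7)
  ... | 1                       , refl = moves8  , from-yes (clears? 8  cubePositions (const 1) moves8)
  ... | 2                       , refl = moves9  , from-yes (clears? 9  cubePositions (const 1) moves9)
  ... | 3                       , refl = moves10 , from-yes (clears? 10 cubePositions (const 1) moves10)
  ... | suc (suc (suc (suc _))) , refl = ⊥-elim (1+n≰n (m+n≤o⇒m≤o 11 m≤10))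

open Certificates using (certificate)

module Lifting {n} {C B A : Subset n} (chain : Saturated (C ∷ B ∷ A ∷ [])) (∣C∣≢0 : ∣ C ∣ ≢ 0)
  where

  element : Fin 3 → Subset n
  element = lookup (C ∷ B ∷ A ∷ [])

  element-injective : ∀ i j → element i ≡ element j → i ≡ j
  element-injective i j eq = toℕ-injective (∣m-n∣≡0⇒m≡n (begin
    ∣ toℕ i - toℕ j ∣             ≡⟨ dist-lookup chain i j ⟨
    dist (element i) (element j) ≡⟨ cong (dist (element i)) eq ⟨
    dist (element i) (element i) ≡⟨ dist-refl (element i) ⟩
    0                            ∎))
    where open ≡-Reasoning

  element≢zeroV : ∀ i → element i ≢ zeroV n
  element≢zeroV i eq = ∣C∣≢0 (m+n≡0⇒n≡0 (toℕ i) (begin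
    toℕ i + ∣ C ∣ ≡⟨ ∣lookup∣ chain i ⟨
    ∣ element i ∣ ≡⟨ cong ∣_∣ eq ⟩
    ∣ zeroV n ∣   ≡⟨ ∣⊥∣≡0 n ⟩
    0             ∎))
    where open ≡-Reasoning

  vertex : Pos → Vertex (n + 3)
  vertex (cube i x) = element i ++ x
  vertex origin     = zeroV (n + 3)

  dist-element-zeroV : ∀ i → dist (element i) (zeroV n) ≡ toℕ i + ∣ C ∣
  dist-element-zeroV i = trans (dist-zeroV (element i)) (∣lookup∣ chain i)

  dist-vertex : ∀ p q → dist (vertex p) (vertex q) ≡ δ ∣ C ∣ p q
  dist-vertex (cube i x) (cube j y) =
    trans (dist-++ (element i) (element j) x y) (cong (_+ dist x y) (dist-lookup chain i j))
  dist-vertex (cube i x) origin rewrite zeroV-++ n {3} =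
    trans (dist-++ (element i) (zeroV n) x (zeroV 3))
          (cong (_+ dist x (zeroV 3)) (dist-element-zeroV i))
  dist-vertex origin (cube j y) rewrite zeroV-++ n {3} =
    trans (dist-++ (zeroV n) (element j) (zeroV 3) y)
          (cong (_+ dist (zeroV 3) y) (trans (dist-sym (zeroV n) (element j)) (dist-element-zeroV j)))
  dist-vertex origin origin = dist-refl (zeroV (n + 3))

  -- The same case split as in `initConfig` and `cubes3`, which makes `initConfig≗lift` immediate.
  classify : (w : Vertex (n + 3)) →
             Dec (label n w ≡ A) → Dec (label n w ≡ B) → Dec (label n w ≡ C) → Dec (w ≡ zeroV (n + 3)) →
             Maybe Pos
  classify w (yes _) _       _       _       = just (cube 2F (drop n w))
  classify w (no _)  (yes _) _       _       = just (cube 1F (drop n w))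
  classify w (no _)  (no _)  (yes _) _       = just (cube 0F (drop n w))
  classify w (no _)  (no _)  (no _)  (yes _) = just origin
  classify w (no _)  (no _)  (no _)  (no _)  = nothing

  position : Vertex (n + 3) → Maybe Pos
  position w =
    classify w (label n w ≟ˢ A) (label n w ≟ˢ B) (label n w ≟ˢ C) (≡-dec _≟ᵇ_ w (zeroV (n + 3)))

  take++drop : ∀ (w : Vertex (n + 3)) {S} → label n w ≡ S → S ++ drop n w ≡ w
  take++drop w refl = take++drop≡id n w

  vertex-classify : ∀ w d₂ d₁ d₀ d {p} → classify w d₂ d₁ d₀ d ≡ just p → vertex p ≡ w
  vertex-classify w (yes eq) _        _        _        refl = take++drop w eq
  vertex-classify w (no _)   (yes eq) _        _        refl = take++drop w eq
  vertex-classify w (no _)   (no _)   (yes eq) _        refl = take++drop w eq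
  vertex-classify w (no _)   (no _)   (no _)   (yes eq) refl = sym eq
  vertex-classify w (no _)   (no _)   (no _)   (no _)   ()

  vertex-position : ∀ {w p} → position w ≡ just p → vertex p ≡ w
  vertex-position {w} = vertex-classify w _ _ _ _

  classify-element : ∀ w i → label n w ≡ element i → ∀ d₂ d₁ d₀ d →
                     classify w d₂ d₁ d₀ d ≡ just (cube i (drop n w))
  classify-element w 2F eq (yes _)   _         _       _ = refl
  classify-element w 2F eq (no ≢A)   _         _       _ = contradiction eq ≢A
  classify-element w 1F eq (yes eq′) _         _       _ = contradiction (element-injective 2F 1F (trans (sym eq′) eq)) λ ()
  classify-element w 1F eq (no _)    (yes _)   _       _ = refl
  classify-element w 1F eq (no _)    (no ≢B)   _       _ = contradiction eq ≢B
  classify-element w 0F eq (yes eq′) _         _       _ = contradiction (element-injective 2F 0F (trans (sym eq′) eq)) λ ()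
  classify-element w 0F eq (no _)    (yes eq′) _       _ = contradiction (element-injective 1F 0F (trans (sym eq′) eq)) λ ()
  classify-element w 0F eq (no _)    (no _)    (yes _) _ = refl
  classify-element w 0F eq (no _)    (no _)    (no ≢C) _ = contradiction eq ≢C

  label-zeroV : label n (zeroV (n + 3)) ≡ zeroV n
  label-zeroV = trans (cong (take n) (zeroV-++ n)) (take-++ n (zeroV n) (zeroV 3))

  classify-zeroV : ∀ d₂ d₁ d₀ d → classify (zeroV (n + 3)) d₂ d₁ d₀ d ≡ just origin
  classify-zeroV (yes eq) _        _        _       = contradiction (trans (sym eq) label-zeroV) (element≢zeroV 2F)
  classify-zeroV (no _)   (yes eq) _        _       = contradiction (trans (sym eq) label-zeroV) (element≢zeroV 1F)
  classify-zeroV (no _)   (no _)   (yes eq) _       = contradiction (trans (sym eq) label-zeroV) (element≢zeroV 0F)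
  classify-zeroV (no _)   (no _)   (no _)   (yes _) = refl
  classify-zeroV (no _)   (no _)   (no _)   (no ≢0) = contradiction refl ≢0

  position-vertex : ∀ p → position (vertex p) ≡ just p
  position-vertex (cube i x) =
    trans (classify-element (element i ++ x) i (take-++ n (element i) x) _ _ _ _)
          (cong (λ y → just (cube i y)) (drop-++ n (element i) x))
  position-vertex origin = classify-zeroV _ _ _ _

  lift : (Pos → ℕ) → Config (n + 3)
  lift c w = maybe′ c 0 (position w)

  lift-vertex : ∀ c p → lift c (vertex p) ≡ c p
  lift-vertex c p rewrite position-vertex p = refl

  lift-stack-elsewhere : ∀ c {u v} w → w ≢ vertex u → w ≢ vertex v →
                         lift (stack ∣ C ∣ c (u , v)) w ≡ lift c w
  lift-stack-elsewhere c w w≢u w≢v with position w in eq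
  ... | nothing = refl
  ... | just p  = stack-elsewhere ∣ C ∣ c (λ { refl → w≢u (sym (vertex-position eq)) })
                                          (λ { refl → w≢v (sym (vertex-position eq)) })

  lift-legal : ∀ c {u v} → Legal ∣ C ∣ c (u , v) → Move (lift c) (lift (stack ∣ C ∣ c (u , v)))
  lift-legal c {u} {v} (1≤u , 1≤v , δ≡) =
    vertex u , vertex v ,
    subst (1 ≤_) (sym (lift-vertex c u)) 1≤u ,
    subst (1 ≤_) (sym (lift-vertex c v)) 1≤v ,
    trans (dist-vertex u v) (trans δ≡ (sym (lift-vertex c u))) ,
    trans (lift-vertex _ u) (stack-source ∣ C ∣ c u v) ,
    trans (lift-vertex _ v)
          (trans (stack-target ∣ C ∣ c v≢u) (sym (cong₂ _+_ (lift-vertex c v) (lift-vertex c u)))) ,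
    lift-stack-elsewhere c
    where
    v≢u : v ≢ u
    v≢u refl = 1+n≰n (subst (1 ≤_) (trans (sym δ≡) (trans (sym (dist-vertex u u)) (dist-refl (vertex u)))) 1≤u)

  lift-cleared : ∀ c → All (λ p → c p ≡ 0) cubePositions → ∀ w → w ≢ zeroV (n + 3) → lift c w ≡ 0
  lift-cleared c cleared w w≢0 with position w in eq
  ... | nothing         = refl
  ... | just (cube i x) = All.lookup cleared (∈-cubePositions i x)
  ... | just origin     = contradiction (sym (vertex-position eq)) w≢0

  lift-clears : ∀ {D} c ms → D ≗ lift c → Clears ∣ C ∣ cubePositions c ms →
                ∃ λ D′ → Star Move D D′ × (∀ w → w ≢ zeroV (n + 3) → D′ w ≡ 0)
  lift-clears c [] D≗ cleared = _ , ε , λ w w≢0 → trans (D≗ w) (lift-cleared c cleared w w≢0)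
  lift-clears c ((u , v) ∷ ms) D≗ (legal , clears)
    with lift-clears (stack ∣ C ∣ c (u , v)) ms (λ _ → refl) clears
  ... | D′ , play , cleared = D′ , Move-respˡ D≗ (lift-legal c legal) ◅ play , cleared

  initConfig≗lift : initConfig (n + 3) (cubes3 n A B C) ≗ lift (const 1)
  initConfig≗lift w =
    initial-classify (label n w ≟ˢ A) (label n w ≟ˢ B) (label n w ≟ˢ C) (≡-dec _≟ᵇ_ w (zeroV (n + 3)))
    where
    initial-classify : ∀ d₂ d₁ d₀ d → (if (does d₂ ∨ does d₁ ∨ does d₀) ∨ does d then 1 else 0)
                                    ≡ maybe′ (const 1) 0 (classify w d₂ d₁ d₀ d)
    initial-classify (yes _) _       _       _       = refl
    initial-classify (no _)  (yes _) _       _       = refl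
    initial-classify (no _)  (no _)  (yes _) _       = refl
    initial-classify (no _)  (no _)  (no _)  (yes _) = refl
    initial-classify (no _)  (no _)  (no _)  (no _)  = refl

  zeroStackable : ∀ {ms} → Clears ∣ C ∣ cubePositions (const 1) ms →
                  ZeroStackable (n + 3) (cubes3 n A B C)
  zeroStackable clears = lift-clears (const 1) _ initConfig≗lift clears

-- The bounds l ≤ n and n + 3 ≤ 2l only make A, φ(A) and φ(B) meaningful; PhiOf supplies them.
lemma25 : (l n : ℕ) → 9 ≤ l → l ≤ 12 → l ≤ n → n + 3 ≤ 2 * l →
    (𝒞 : List (List (Subset n))) → IsSCD n 𝒞 →
    (A B C : Subset n) → ∣ A ∣ ≡ l → PhiOf 𝒞 A B → PhiOf 𝒞 B C →
    ZeroStackable (n + 3) (cubes3 n A B C)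
lemma25 l n 9≤l l≤12 _ _ 𝒞 scd A B C ∣A∣≡l φAB φBC =
  zeroStackable (proj₂ (certificate 7≤∣C∣ ∣C∣≤10))
  where
  chain : Saturated (C ∷ B ∷ A ∷ [])
  chain = phi-saturated scd φAB φBC

  l≡2+∣C∣ : l ≡ 2 + ∣ C ∣
  l≡2+∣C∣ = trans (sym ∣A∣≡l) (∣lookup∣ chain 2F)

  7≤∣C∣ : 7 ≤ ∣ C ∣
  7≤∣C∣ = +-cancelˡ-≤ 2 _ _ (subst (9 ≤_) l≡2+∣C∣ 9≤l)

  ∣C∣≤10 : ∣ C ∣ ≤ 10
  ∣C∣≤10 = +-cancelˡ-≤ 2 _ _ (subst (_≤ 12) l≡2+∣C∣ l≤12)

  open Lifting chain (m<n⇒n≢0 7≤∣C∣)
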